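{- Let $t,p$ be positive integers. For $1\leq i\leq t-1$ let $\gamma_i$ be the partition whose $\beta$-set is \[ \beta(\gamma_i)=\bigcup_{k=1}^{\lfloor (i-1)/p\rfloor+1}\{x\in\mathbb{Z}: kt-(i-(k-1)p)\leq x\leq kt-1\}, \] let $\gamma_0$ be the empty partition, and let $f(i)=|\gamma_i|$ for $0\leq i\leq t-1$. Suppose $1\leq i\leq p$, $m\geq 0$ are integers with $pm+i\leq t-1$. Then (1) $f(pm+i)-f(pm+i-1)=\binom{m+2}{2}(t-pm-2i+1)$; (2) $f(pm+i)-f(pm)=\binom{m+2}{2}(it-ipm-i^2)$.
   Context: A partition is a finite weakly decreasing sequence $(\lambda_1,\ldots,\lambda_r)$ of positive integers, with size $|\lambda|=\sum_i\lambda_i$. The $\beta$-set of $\lambda$ is the set of hook lengths $h(i,1)$, $1\leq i\leq r$, of the boxes in the first column of its Young diagram (hook length of a box = number of boxes directly to its right, directly below it, plus itself). Every finite set of positive integers is the $\beta$-set of a unique partition, and $|\lambda|=\sum_{x\in\beta(\lambda)}x-\binom{\#\beta(\lambda)}{2}$. $\lfloor x\rfloor$ is the floor. -}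

module Defs where

open import Data.Nat using (ℕ; zero; suc; _+_; _*_; _∸_; _≤_; _≤ᵇ_; NonZero)
open import Data.Nat.DivMod using (_/_)
open import Data.Bool using (Bool; true; false)
open import Data.List using (List; []; _∷_; length; filter; map; upTo)
open import Data.Nat.ListAction using (sum)
open import Data.List.Relation.Unary.All using (All)
open import Data.List.Relation.Unary.Linked using (Linked)
open import Data.List.Membership.Propositional using (_∈_)
open import Data.Nat.Properties using (_≤?_)
open import Data.Integer as ℤ using (ℤ; +_)
open import Data.Product using (Σ; ∃; _×_)
open import Relation.Binary.PropositionalEquality using (_≡_)
open import Function.Bundles using (_⇔_)

record Partition : Set where
  constructor mkPartition
  field
    parts      : List ℕ
    positive   : All (λ x → 1 ≤ x) parts
    decreasing : Linked (λ a b → b ≤ a) parts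
open Partition public

size : Partition → ℕ
size λ' = sum (parts λ')

-- λ_i (1-indexed row length; 0 outside the partition)
row : List ℕ → ℕ → ℕ
row []       _             = 0
row (x ∷ xs) zero          = 0
row (x ∷ xs) (suc zero)    = x
row (x ∷ xs) (suc (suc i)) = row xs (suc i)

col : List ℕ → ℕ → ℕ
col xs j = length (filter (λ x → j ≤? x) xs)

-- hook length of box (i,j) (1-indexed): arm + leg + 1
hook : Partition → ℕ → ℕ → ℕ
hook λ' i j = (row (parts λ') i ∸ j) + (col (parts λ') j ∸ i) + 1

-- β-set: hook lengths h(i,1), 1 ≤ i ≤ r, of the first column (as a list)
betaSet : Partition → List ℕ
betaSet λ' = map (λ i → hook λ' (suc i) 1) (upTo (length (parts λ')))

InB : (t p i : ℕ) → .{{NonZero p}} → ℤ → Set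
InB t p i x = Σ ℕ λ k → (1 ≤ k) × (k ≤ ((i ∸ 1) / p) + 1) ×
  ((+ (k * t) ℤ.- (+ i ℤ.- + ((k ∸ 1) * p)) ℤ.≤ x) × (x ℤ.≤ + (k * t) ℤ.- + 1))

IsGamma : (t p i : ℕ) → .{{NonZero p}} → Partition → Set
IsGamma t p zero    λ' = parts λ' ≡ []
IsGamma t p (suc j) λ' = (x : ℕ) → (x ∈ betaSet λ') ⇔ InB t p (suc j) (+ x)

module Submission where

-- Proof of Lemma 3.4.  For 0 ≤ c ≤ p and pm + c ≤ t the β-set of γ_{pm+c} is the
-- disjoint union, over k = 1, …, m+1, of the "blocks" of the ℓ_k largest naturals below
-- kt, where ℓ_k = p(m+1-k) + c.  We write this set down explicitly as a strictly
-- decreasing list (the staircase) and identify it with betaSet γ, using that a strictly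
-- decreasing list is determined by its members.  The size of a partition is recovered
-- from its β-set by  |λ| + C(r,2) = Σ β(λ),  r = #β(λ).
--
-- Passing from c to c+1 adds one element, kt - ℓ_k - 1, to every block.  Counting how the
-- sum and the length of the staircase change gives the balance
--     |γ_{pm+c+1}| + C(m+2,2)·(pm + 2c + 1) = |γ_{pm+c}| + C(m+2,2)·t,
-- which is part (1); summing it over c = 0, …, i-1 gives part (2).

open import Defs
open import Data.Nat using (ℕ; zero; suc; _+_; _*_; _∸_; _≤_; _<_; z≤n; s≤s; NonZero; >-nonZero⁻¹)
open import Data.Nat.Properties
open import Algebra.Properties.CommutativeSemigroup +-commutativeSemigroup using (xy∙z≈xz∙y)
open import Algebra.Properties.CommutativeSemigroup *-commutativeSemigroup using ()
  renaming (x∙yz≈y∙xz to *-left-comm)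
open import Data.Nat.Combinatorics using (_C_; nC1≡n; nCk+nC[k+1]≡[n+1]C[k+1])
open import Data.Nat.ListAction using (sum)
open import Data.Nat.ListAction.Properties using (sum-++)
open import Data.List using (List; []; _∷_; _++_; length; map; upTo; applyUpTo; applyDownFrom)
open import Data.List.Properties using (map-upTo; filter-all; length-++; length-applyDownFrom)
open import Data.List.Relation.Unary.All as All using (All; []; _∷_)
open import Data.List.Relation.Unary.AllPairs using (AllPairs; []; _∷_)
open import Data.List.Relation.Unary.AllPairs.Properties using (++⁺)
open import Data.List.Relation.Unary.Linked.Properties using (Linked⇒AllPairs)
open import Data.List.Relation.Unary.Any using (here; there)
open import Data.List.Membership.Propositional using (_∈_)
open import Data.List.Membership.Propositional.Properties using (∈-++⁺ˡ; ∈-++⁺ʳ; ∈-++⁻)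
open import Data.Integer as ℤ using (+_; +≤+)
import Data.Integer.Properties as ℤP
open import Data.Nat.DivMod using (_/_; m*n/n≡m; /-monoˡ-≤)
open import Function.Bundles using (Equivalence; _⇔_; mk⇔)
open import Data.Product using (Σ; _×_; _,_; proj₂)
open import Data.Sum using (inj₁; inj₂)
open import Data.Empty using (⊥-elim)
open import Relation.Binary.PropositionalEquality
import Data.Nat.Tactic.RingSolver as ℕ-Solver
import Data.Integer.Tactic.RingSolver as ℤ-Solver

open ≡-Reasoning

≤-shrink : ∀ {a c t} → a + suc c ≤ t → a + c ≤ t
≤-shrink {a} {c} {t} a+c+1≤t = <⇒≤ (subst (_≤ t) (+-suc a c) a+c+1≤t)

-- Pascal's rule for pairs: an (n+1)-st element forms a new pair with each of the others.
suc-C2 : ∀ n → suc n C 2 ≡ n + n C 2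
suc-C2 n = sym (trans (cong (_+ n C 2) (sym (nC1≡n n))) (nCk+nC[k+1]≡[n+1]C[k+1] n 1))

C2-+ : ∀ a b → (a + b) C 2 ≡ a C 2 + a * b + b C 2
C2-+ zero    b = refl
C2-+ (suc a) b = begin
  suc (a + b) C 2                    ≡⟨ suc-C2 (a + b) ⟩
  a + b + (a + b) C 2                ≡⟨ cong (_+_ (a + b)) (C2-+ a b) ⟩
  a + b + (a C 2 + a * b + b C 2)    ≡⟨ regroup a b (a C 2) (a * b) (b C 2) ⟩
  a + a C 2 + (b + a * b) + b C 2    ≡⟨ cong (λ x → x + (b + a * b) + b C 2) (sym (suc-C2 a)) ⟩
  suc a C 2 + suc a * b + b C 2      ∎
  where
  regroup : ∀ a b x y z → a + b + (x + y + z) ≡ a + x + (b + y) + z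
  regroup = ℕ-Solver.solve-∀

-- C(n+1,2) = (n+1)n/2, in division-free form.
double-C2 : ∀ n → 2 * (suc n C 2) ≡ suc n * n
double-C2 zero    = refl
double-C2 (suc n) = begin
  2 * (suc (suc n) C 2)           ≡⟨ cong (2 *_) (suc-C2 (suc n)) ⟩
  2 * (suc n + suc n C 2)         ≡⟨ *-distribˡ-+ 2 (suc n) (suc n C 2) ⟩
  2 * suc n + 2 * (suc n C 2)     ≡⟨ cong (_+_ (2 * suc n)) (double-C2 n) ⟩
  2 * suc n + suc n * n           ≡⟨ regroup n ⟩
  suc (suc n) * suc n             ∎
  where
  regroup : ∀ n → 2 * suc n + suc n * n ≡ suc (suc n) * suc n
  regroup = ℕ-Solver.solve-∀

-- (m+2)·C(m+1,2) = m·C(m+2,2); both are (m+2)(m+1)m/2.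
C2-shift : ∀ m → suc (suc m) * (suc m C 2) ≡ m * (suc (suc m) C 2)
C2-shift m = *-cancelˡ-≡ _ _ 2 (begin
  2 * (suc (suc m) * (suc m C 2))  ≡⟨ *-left-comm 2 (suc (suc m)) (suc m C 2) ⟩
  suc (suc m) * (2 * (suc m C 2))  ≡⟨ cong (suc (suc m) *_) (double-C2 m) ⟩
  suc (suc m) * (suc m * m)        ≡⟨ regroup m ⟩
  m * (suc (suc m) * suc m)        ≡⟨ cong (m *_) (sym (double-C2 (suc m))) ⟩
  m * (2 * (suc (suc m) C 2))      ≡⟨ *-left-comm m 2 _ ⟩
  2 * (m * (suc (suc m) C 2))      ∎)
  where
  regroup : ∀ m → suc (suc m) * (suc m * m) ≡ m * (suc (suc m) * suc m)
  regroup = ℕ-Solver.solve-∀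

StrictlyDecreasing : List ℕ → Set
StrictlyDecreasing = AllPairs (λ a b → b < a)

-- The first-column hook lengths of a partition with parts xs: each part plus the number
-- of parts after it.
firstColumnHooks : List ℕ → List ℕ
firstColumnHooks []       = []
firstColumnHooks (x ∷ xs) = x + length xs ∷ firstColumnHooks xs

col-1 : ∀ xs → All (1 ≤_) xs → col xs 1 ≡ length xs
col-1 xs positive = cong length (filter-all (1 ≤?_) positive)

hooks-by-row : ∀ xs → All (1 ≤_) xs →
  applyUpTo (λ i → (row xs (suc i) ∸ 1) + (length xs ∸ suc i) + 1) (length xs)
    ≡ firstColumnHooks xs
hooks-by-row []           _              = refl
hooks-by-row (suc x ∷ xs) (_ ∷ positive) =
  cong₂ _∷_ (+-comm (x + length xs) 1) (hooks-by-row xs positive)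

betaSet≡firstColumnHooks : ∀ λ' → betaSet λ' ≡ firstColumnHooks (parts λ')
betaSet≡firstColumnHooks λ' = begin
  map (λ i → hook λ' (suc i) 1) (upTo (length xs))
    ≡⟨ map-upTo _ (length xs) ⟩
  applyUpTo (λ i → (row xs (suc i) ∸ 1) + (col xs 1 ∸ suc i) + 1) (length xs)
    ≡⟨ cong (λ r → applyUpTo (λ i → (row xs (suc i) ∸ 1) + (r ∸ suc i) + 1) (length xs))
            (col-1 xs (positive λ')) ⟩
  applyUpTo (λ i → (row xs (suc i) ∸ 1) + (length xs ∸ suc i) + 1) (length xs)
    ≡⟨ hooks-by-row xs (positive λ') ⟩
  firstColumnHooks xs ∎
  where xs = parts λ'

length-firstColumnHooks : ∀ xs → length (firstColumnHooks xs) ≡ length xs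
length-firstColumnHooks []       = refl
length-firstColumnHooks (x ∷ xs) = cong suc (length-firstColumnHooks xs)

sum-firstColumnHooks : ∀ xs → sum (firstColumnHooks xs) ≡ sum xs + length xs C 2
sum-firstColumnHooks []       = refl
sum-firstColumnHooks (x ∷ xs) = begin
  x + r + sum (firstColumnHooks xs)  ≡⟨ cong (_+_ (x + r)) (sum-firstColumnHooks xs) ⟩
  x + r + (sum xs + r C 2)           ≡⟨ regroup x r (sum xs) (r C 2) ⟩
  x + sum xs + (r + r C 2)           ≡⟨ cong (_+_ (x + sum xs)) (sym (suc-C2 r)) ⟩
  x + sum xs + suc r C 2             ∎
  where
  r = length xs
  regroup : ∀ a b c d → a + b + (c + d) ≡ a + c + (b + d)
  regroup = ℕ-Solver.solve-∀

firstColumnHooks-bounded : ∀ B ys → All (_≤ B) ys → All (_< B + length ys) (firstColumnHooks ys)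
firstColumnHooks-bounded B []       _            = []
firstColumnHooks-bounded B (y ∷ ys) (y≤B ∷ ys≤B) =
  head< ∷ All.map (λ z< → <-≤-trans z< (+-monoʳ-≤ B (n≤1+n _)))
                  (firstColumnHooks-bounded B ys ys≤B)
  where
  head< : y + length ys < B + suc (length ys)
  head< = subst (y + length ys <_) (sym (+-suc B (length ys))) (s≤s (+-monoˡ-≤ (length ys) y≤B))

firstColumnHooks-decreasing : ∀ xs → AllPairs (λ a b → b ≤ a) xs →
                              StrictlyDecreasing (firstColumnHooks xs)
firstColumnHooks-decreasing []       []            = []
firstColumnHooks-decreasing (x ∷ xs) (xs≤x ∷ rest) =
  firstColumnHooks-bounded x xs xs≤x ∷ firstColumnHooks-decreasing xs rest

betaSet-decreasing : ∀ λ' → StrictlyDecreasing (betaSet λ')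
betaSet-decreasing λ' =
  subst StrictlyDecreasing (sym (betaSet≡firstColumnHooks λ'))
    (firstColumnHooks-decreasing (parts λ')
      (Linked⇒AllPairs (λ b≤a c≤b → ≤-trans c≤b b≤a) (decreasing λ')))

size-betaSet : ∀ λ' → size λ' + length (betaSet λ') C 2 ≡ sum (betaSet λ')
size-betaSet λ' rewrite betaSet≡firstColumnHooks λ' | length-firstColumnHooks (parts λ') =
  sym (sum-firstColumnHooks (parts λ'))

≤-head : ∀ {x xs z} → All (_< x) xs → z ∈ x ∷ xs → z ≤ x
≤-head _    (here refl)  = ≤-refl
≤-head xs<x (there z∈xs) = <⇒≤ (All.lookup xs<x z∈xs)

∈-tail : ∀ {x ys z} → z < x → z ∈ x ∷ ys → z ∈ ys
∈-tail z<x (here refl)  = ⊥-elim (<-irrefl refl z<x)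
∈-tail _   (there z∈ys) = z∈ys

decreasing-ext : ∀ {xs ys} → StrictlyDecreasing xs → StrictlyDecreasing ys →
                 (∀ {z} → z ∈ xs → z ∈ ys) → (∀ {z} → z ∈ ys → z ∈ xs) → xs ≡ ys
decreasing-ext []      []      _  _    = refl
decreasing-ext []      (_ ∷ _) _  from with () ← from (here refl)
decreasing-ext (_ ∷ _) []      to _    with () ← to (here refl)
decreasing-ext {x ∷ xs} {y ∷ ys} (xs<x ∷ xs↓) (ys<y ∷ ys↓) to from =
  cong₂ _∷_ x≡y (decreasing-ext xs↓ ys↓ to′ from′)
  where
  x≡y : x ≡ y
  x≡y = ≤-antisym (≤-head ys<y (to (here refl))) (≤-head xs<x (from (here refl)))
  to′ : ∀ {z} → z ∈ xs → z ∈ ys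
  to′ z∈xs = ∈-tail (subst (_ <_) x≡y (All.lookup xs<x z∈xs)) (to (there z∈xs))
  from′ : ∀ {z} → z ∈ ys → z ∈ xs
  from′ z∈ys = ∈-tail (subst (_ <_) (sym x≡y) (All.lookup ys<y z∈ys)) (from (there z∈ys))

length-below : ∀ {x xs} → All (_< x) xs → StrictlyDecreasing xs → length xs ≤ x
length-below []        []           = z≤n
length-below (y<x ∷ _) (ys<y ∷ ys↓) = ≤-trans (s≤s (length-below ys<y ys↓)) y<x

-- Distinct naturals sum to at least 0 + 1 + ⋯ + (r-1) = C(r,2); this makes Σβ - C(#β,2)
-- an honest difference.
C2≤sum : ∀ xs → StrictlyDecreasing xs → length xs C 2 ≤ sum xs
C2≤sum []       []           = z≤n
C2≤sum (x ∷ xs) (xs<x ∷ xs↓) =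
  subst (_≤ x + sum xs) (sym (suc-C2 (length xs)))
    (+-mono-≤ (length-below xs<x xs↓) (C2≤sum xs xs↓))

interval : ℕ → ℕ → List ℕ
interval b = applyDownFrom (_+_ b)

∈-interval⁻ : ∀ b ℓ {x} → x ∈ interval b ℓ → b ≤ x × x < b + ℓ
∈-interval⁻ b (suc ℓ) (here refl)  = m≤m+n b ℓ , +-monoʳ-< b (n<1+n ℓ)
∈-interval⁻ b (suc ℓ) (there x∈) with ∈-interval⁻ b ℓ x∈
... | b≤x , x< = b≤x , <-trans x< (+-monoʳ-< b (n<1+n ℓ))

∈-interval⁺ : ∀ b ℓ {x} → b ≤ x → x < b + ℓ → x ∈ interval b ℓ
∈-interval⁺ b zero    {x} b≤x x< = ⊥-elim (<⇒≱ (subst (x <_) (+-identityʳ b) x<) b≤x)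
∈-interval⁺ b (suc ℓ) {x} b≤x x< with m<1+n⇒m<n∨m≡n (subst (x <_) (+-suc b ℓ) x<)
... | inj₁ x<b+ℓ = there (∈-interval⁺ b ℓ b≤x x<b+ℓ)
... | inj₂ refl  = here refl

interval-decreasing : ∀ b ℓ → StrictlyDecreasing (interval b ℓ)
interval-decreasing b zero    = []
interval-decreasing b (suc ℓ) =
  All.tabulate (λ x∈ → proj₂ (∈-interval⁻ b ℓ x∈)) ∷ interval-decreasing b ℓ

sum-interval-shift : ∀ b ℓ → sum (interval b (suc ℓ)) ≡ b + sum (interval (suc b) ℓ)
sum-interval-shift b zero    = +-identityʳ (b + 0)
sum-interval-shift b (suc ℓ) = begin
  b + suc ℓ + sum (interval b (suc ℓ))   ≡⟨ cong (_+_ (b + suc ℓ)) (sum-interval-shift b ℓ) ⟩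
  b + suc ℓ + (b + sum (interval (suc b) ℓ)) ≡⟨ regroup b ℓ (sum (interval (suc b) ℓ)) ⟩
  b + (suc b + ℓ + sum (interval (suc b) ℓ)) ∎
  where
  regroup : ∀ b ℓ s → b + suc ℓ + (b + s) ≡ b + (suc b + ℓ + s)
  regroup = ℕ-Solver.solve-∀

-- block t k ℓ lists the ℓ largest naturals below kt, i.e. the integers of
-- [kt - ℓ, kt - 1]  (when ℓ ≤ kt).
block : ℕ → ℕ → ℕ → List ℕ
block t k ℓ = interval (k * t ∸ ℓ) ℓ

∈-block⁻ : ∀ t k ℓ {x} → ℓ ≤ k * t → x ∈ block t k ℓ → k * t ≤ x + ℓ × x < k * t
∈-block⁻ t k ℓ {x} ℓ≤kt x∈ with ∈-interval⁻ (k * t ∸ ℓ) ℓ x∈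
... | lo , hi = subst (_≤ x + ℓ) (m∸n+n≡m ℓ≤kt) (+-monoˡ-≤ ℓ lo)
              , subst (x <_) (m∸n+n≡m ℓ≤kt) hi

∈-block⁺ : ∀ t k ℓ {x} → ℓ ≤ k * t → k * t ≤ x + ℓ → x < k * t → x ∈ block t k ℓ
∈-block⁺ t k ℓ {x} ℓ≤kt lo hi =
  ∈-interval⁺ (k * t ∸ ℓ) ℓ (m≤n+o⇒m∸n≤o (k * t) ℓ (subst (k * t ≤_) (+-comm x ℓ) lo))
                          (subst (x <_) (sym (m∸n+n≡m ℓ≤kt)) hi)

-- Lengthening a block by one adds the element kt - ℓ - 1 to it.
block-grow : ∀ t k ℓ → suc ℓ ≤ k * t →
             sum (block t k (suc ℓ)) + suc ℓ ≡ k * t + sum (block t k ℓ)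
block-grow t k ℓ sℓ≤kt = begin
  sum (interval b (suc ℓ)) + suc ℓ      ≡⟨ cong (_+ suc ℓ) (sum-interval-shift b ℓ) ⟩
  b + sum (interval (suc b) ℓ) + suc ℓ  ≡⟨ xy∙z≈xz∙y b _ (suc ℓ) ⟩
  b + suc ℓ + sum (interval (suc b) ℓ)  ≡⟨ cong₂ _+_ (m∸n+n≡m sℓ≤kt)
                                                  (cong (λ a → sum (interval a ℓ)) (sym (+-∸-assoc 1 sℓ≤kt))) ⟩
  k * t + sum (interval (k * t ∸ ℓ) ℓ)  ∎
  where b = k * t ∸ suc ℓ

module _ (t p : ℕ) where

  -- staircase c K j: the blocks of indices k = K, K-1, …, 1 (top block first), where
  -- block k has length p(j + K - k) + c.  For K = m+1, j = 0 this will be β(γ_{pm+c}).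
  staircase : (c K j : ℕ) → List ℕ
  staircase c zero    j = []
  staircase c (suc K) j = block t (suc K) (p * j + c) ++ staircase c K (suc j)

  -- No block is longer than t: the longest one, of index 1, has length p(K-1+j) + c ≤ t
  -- (stated without subtraction).
  Fits : (c K j : ℕ) → Set
  Fits c K j = p * (K + j) + c ≤ t + p

  fits-head : ∀ c K j → Fits c (suc K) j → p * j + c ≤ t
  fits-head c K j fits = ≤-trans (+-monoˡ-≤ c (*-monoʳ-≤ p (m≤n+m j K))) longest≤t
    where
    longest≤t : p * (K + j) + c ≤ t
    longest≤t = +-cancelˡ-≤ p _ _
      (subst₂ _≤_ (trans (cong (_+ c) (*-suc p (K + j))) (+-assoc p _ c)) (+-comm t p) fits)

  fits-tail : ∀ c K j → Fits c (suc K) j → Fits c K (suc j)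
  fits-tail c K j = subst (λ n → p * n + c ≤ t + p) (sym (+-suc K j))

  top-block≤ : ∀ c K j → Fits c (suc K) j → p * j + c ≤ suc K * t
  top-block≤ c K j fits = ≤-trans (fits-head c K j fits) (m≤m+n t (K * t))

  -- x lies in block k+1 of staircase c K j, where K = k+1+d, so that this block has
  -- length p(j+d) + c.
  InStaircase : (c K j x : ℕ) → Set
  InStaircase c K j x = Σ ℕ λ k → Σ ℕ λ d →
    suc (k + d) ≡ K × suc k * t ≤ x + (p * (j + d) + c) × x < suc k * t

  ∈-staircase⁻ : ∀ c K j {x} → Fits c K j → x ∈ staircase c K j → InStaircase c K j x
  ∈-staircase⁻ c (suc K) j {x} fits x∈ with ∈-++⁻ (block t (suc K) (p * j + c)) x∈
  ... | inj₁ x∈top with ∈-block⁻ t (suc K) (p * j + c) (top-block≤ c K j fits) x∈top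
  ...   | lo , hi = K , 0 , cong suc (+-identityʳ K)
                  , subst (λ n → suc K * t ≤ x + (p * n + c)) (sym (+-identityʳ j)) lo , hi
  ∈-staircase⁻ c (suc K) j {x} fits x∈ | inj₂ x∈rest
    with ∈-staircase⁻ c K (suc j) (fits-tail c K j fits) x∈rest
  ... | k , d , k+d+1≡K , lo , hi = k , suc d , cong suc (trans (+-suc k d) k+d+1≡K)
                                  , subst (λ n → suc k * t ≤ x + (p * n + c)) (sym (+-suc j d)) lo , hi

  ∈-staircase⁺ : ∀ c K j {x} → Fits c K j → InStaircase c K j x → x ∈ staircase c K j
  ∈-staircase⁺ c zero    j     fits (k , d , () , _)
  ∈-staircase⁺ c (suc K) j {x} fits (k , zero , k+1≡K+1 , lo , hi)
    with trans (sym (+-identityʳ k)) (suc-injective k+1≡K+1)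
  ... | refl = ∈-++⁺ˡ (∈-block⁺ t (suc k) (p * j + c) (top-block≤ c k j fits)
                        (subst (λ n → suc k * t ≤ x + (p * n + c)) (+-identityʳ j) lo) hi)
  ∈-staircase⁺ c (suc K) j {x} fits (k , suc d , k+d+2≡K+1 , lo , hi) =
    ∈-++⁺ʳ (block t (suc K) (p * j + c))
      (∈-staircase⁺ c K (suc j) (fits-tail c K j fits)
        (k , d , trans (sym (+-suc k d)) (suc-injective k+d+2≡K+1)
           , subst (λ n → suc k * t ≤ x + (p * n + c)) (+-suc j d) lo , hi))

  staircase-below : ∀ c K j {x} → Fits c K j → x ∈ staircase c K j → x < K * t
  staircase-below c K j fits x∈ with ∈-staircase⁻ c K j fits x∈
  ... | k , d , refl , _ , hi = <-≤-trans hi (*-monoˡ-≤ t (s≤s (m≤m+n k d)))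

  block-above : ∀ K ℓ {x} → ℓ ≤ t → x ∈ block t (suc K) ℓ → K * t ≤ x
  block-above K ℓ {x} ℓ≤t x∈ with ∈-block⁻ t (suc K) ℓ (≤-trans ℓ≤t (m≤m+n t (K * t))) x∈
  ... | lo , _ =
    +-cancelˡ-≤ t _ _ (subst (t + K * t ≤_) (+-comm x t) (≤-trans lo (+-monoʳ-≤ x ℓ≤t)))

  -- Hence a fitting staircase is strictly decreasing: within a block by construction,
  -- and the top block lies above all later ones.
  staircase-decreasing : ∀ c K j → Fits c K j → StrictlyDecreasing (staircase c K j)
  staircase-decreasing c zero    j fits = []
  staircase-decreasing c (suc K) j fits =
    ++⁺ (interval-decreasing _ _) (staircase-decreasing c K (suc j) rest-fits)
        (All.tabulate λ a∈ → All.tabulate λ b∈ →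
          <-≤-trans (staircase-below c K (suc j) rest-fits b∈)
                    (block-above K _ (fits-head c K j fits) a∈))
    where rest-fits = fits-tail c K j fits

  length-staircase : ∀ c K j → length (staircase c K j) ≡ K * (p * j + c) + p * (K C 2)
  length-staircase c zero    j = sym (*-zeroʳ p)
  length-staircase c (suc K) j = begin
    length (block t (suc K) ℓ ++ staircase c K (suc j))
      ≡⟨ length-++ (block t (suc K) ℓ) ⟩
    length (block t (suc K) ℓ) + length (staircase c K (suc j))
      ≡⟨ cong₂ _+_ (length-applyDownFrom _ ℓ) (length-staircase c K (suc j)) ⟩
    ℓ + (K * (p * suc j + c) + p * (K C 2))
      ≡⟨ regroup p j c K (K C 2) ⟩
    suc K * ℓ + p * (K + K C 2)
      ≡⟨ cong (λ n → suc K * ℓ + p * n) (sym (suc-C2 K)) ⟩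
    suc K * ℓ + p * (suc K C 2) ∎
    where
    ℓ = p * j + c
    regroup : ∀ p j c K T → p * j + c + (K * (p * suc j + c) + p * T)
                          ≡ suc K * (p * j + c) + p * (K + T)
    regroup = ℕ-Solver.solve-∀

  -- Lengthening every block by one (c ↦ c+1) adds kt - ℓ_k - 1 to block k, so
  --   Σ staircase_{c+1} + #staircase_c + K = Σ staircase_c + t·C(K+1,2).
  sum-staircase-step : ∀ c K j → Fits (suc c) K j →
    sum (staircase (suc c) K j) + length (staircase c K j) + K
      ≡ sum (staircase c K j) + t * (suc K C 2)
  sum-staircase-step c zero    j fits = sym (*-zeroʳ t)
  sum-staircase-step c (suc K) j fits = begin
    sum (B′ ++ R′) + length (B ++ R) + suc K
      ≡⟨ cong₂ (λ s n → s + n + suc K) (sum-++ B′ R′)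
               (trans (length-++ B) (cong (_+ length R) (length-applyDownFrom _ ℓ))) ⟩
    sum B′ + sum R′ + (ℓ + length R) + suc K
      ≡⟨ regroup (sum B′) (sum R′) ℓ (length R) K ⟩
    (sum B′ + suc ℓ) + (sum R′ + length R + K)
      ≡⟨ cong₂ _+_ top-grows (sum-staircase-step c K (suc j) (fits-tail (suc c) K j fits)) ⟩
    (suc K * t + sum B) + (sum R + t * (suc K C 2))
      ≡⟨ regroup′ K t (sum B) (sum R) (suc K C 2) ⟩
    sum B + sum R + t * (suc K + suc K C 2)
      ≡⟨ cong₂ (λ s n → s + t * n) (sym (sum-++ B R)) (sym (suc-C2 (suc K))) ⟩
    sum (B ++ R) + t * (suc (suc K) C 2) ∎
    where
    ℓ = p * j + c
    B = block t (suc K) ℓ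
    B′ = block t (suc K) (p * j + suc c)
    R = staircase c K (suc j)
    R′ = staircase (suc c) K (suc j)
    suc-ℓ≡ : suc ℓ ≡ p * j + suc c
    suc-ℓ≡ = sym (+-suc (p * j) c)
    top-grows : sum B′ + suc ℓ ≡ suc K * t + sum B
    top-grows = subst (λ ℓ′ → sum (block t (suc K) ℓ′) + suc ℓ ≡ suc K * t + sum B) suc-ℓ≡
      (block-grow t (suc K) ℓ
        (≤-trans (subst (_≤ t) (sym suc-ℓ≡) (fits-head (suc c) K j fits)) (m≤m+n t (K * t))))
    regroup : ∀ a b l n K → a + b + (l + n) + suc K ≡ (a + suc l) + (b + n + K)
    regroup = ℕ-Solver.solve-∀
    regroup′ : ∀ K t a b T → suc K * t + a + (b + t * T) ≡ a + b + t * (suc K + T)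
    regroup′ = ℕ-Solver.solve-∀

ℤ-sub-add : ∀ i k → i ℤ.- k ℤ.+ k ≡ i
ℤ-sub-add = ℤ-Solver.solve-∀

ℤ-add-sub : ∀ i k → i ℤ.+ k ℤ.- k ≡ i
ℤ-add-sub = ℤ-Solver.solve-∀

ℤ-transposeˡ : ∀ i j k → (i ℤ.- k ℤ.≤ j) ⇔ (i ℤ.≤ j ℤ.+ k)
ℤ-transposeˡ i j k = mk⇔
  (λ i-k≤j → subst (ℤ._≤ j ℤ.+ k) (ℤ-sub-add i k) (ℤP.+-monoˡ-≤ k i-k≤j))
  (λ i≤j+k → subst (i ℤ.- k ℤ.≤_) (ℤ-add-sub j k) (ℤP.+-monoˡ-≤ (ℤ.- k) i≤j+k))

ℤ-transposeʳ : ∀ i j k → (i ℤ.≤ j ℤ.- k) ⇔ (i ℤ.+ k ℤ.≤ j)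
ℤ-transposeʳ i j k = mk⇔
  (λ i≤j-k → subst (i ℤ.+ k ℤ.≤_) (ℤ-sub-add j k) (ℤP.+-monoˡ-≤ k i≤j-k))
  (λ i+k≤j → subst (ℤ._≤ j ℤ.- k) (ℤ-add-sub i k) (ℤP.+-monoˡ-≤ (ℤ.- k) i+k≤j))

lower-bound⇔ : ∀ a b n x → (+ a ℤ.- (+ n ℤ.- + b) ℤ.≤ + x) ⇔ (a + b ≤ x + n)
lower-bound⇔ a b n x = mk⇔
  (λ lo → ℤP.drop‿+≤+ (to (subst (ℤ._≤ + x) (rearrange (+ a) (+ b) (+ n)) lo)))
  (λ le → subst (ℤ._≤ + x) (sym (rearrange (+ a) (+ b) (+ n))) (from (+≤+ le)))
  where
  open Equivalence (ℤ-transposeˡ (+ (a + b)) (+ x) (+ n)) using (to; from)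
  rearrange : ∀ a b n → a ℤ.- (n ℤ.- b) ≡ a ℤ.+ b ℤ.- n
  rearrange = ℤ-Solver.solve-∀

upper-bound⇔ : ∀ x a → (+ x ℤ.≤ + a ℤ.- + 1) ⇔ (x < a)
upper-bound⇔ x a = mk⇔
  (λ hi → subst (_≤ a) (+-comm x 1) (ℤP.drop‿+≤+ (to hi)))
  (λ x<a → from (+≤+ (subst (_≤ a) (+-comm 1 x) x<a)))
  where open Equivalence (ℤ-transposeʳ (+ x) (+ a) (+ 1)) using (to; from)

-- The condition InB in ℕ: x lies in the (k+1)-st interval [(k+1)t - (n - kp), (k+1)t - 1].
-- The range restriction on k in InB is automatic once this interval is nonempty.
InLadder : (t p n x : ℕ) → Set
InLadder t p n x = Σ ℕ λ k → suc k * t + k * p ≤ x + n × x < suc k * t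

-- InB with index k+1 is InLadder with index k; for n ≥ 1 the range bound
-- k+1 ≤ ⌊(n-1)/p⌋ + 1 follows from kp < n.
InB⇒InLadder : ∀ t p n x .{{_ : NonZero p}} → InB t p n (+ x) → InLadder t p n x
InB⇒InLadder t p n x (suc k , _ , _ , lo , hi) =
  k , Equivalence.to (lower-bound⇔ (suc k * t) (k * p) n x) lo
    , Equivalence.to (upper-bound⇔ x (suc k * t)) hi

InLadder⇒InB : ∀ t p n x .{{_ : NonZero p}} → InLadder t p (suc n) x → InB t p (suc n) (+ x)
InLadder⇒InB t p n x (k , lo , hi) =
  suc k , s≤s z≤n , k≤bound
        , Equivalence.from (lower-bound⇔ (suc k * t) (k * p) (suc n) x) lo
        , Equivalence.from (upper-bound⇔ x (suc k * t)) hi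
  where
  kp<1+n : k * p < suc n
  kp<1+n = +-cancelˡ-< x (k * p) (suc n) (<-≤-trans (+-monoˡ-< (k * p) hi) lo)
  k≤bound : suc k ≤ n / p + 1
  k≤bound = subst (suc k ≤_) (+-comm 1 (n / p))
    (s≤s (subst (_≤ n / p) (m*n/n≡m k p) (/-monoˡ-≤ p (m<1+n⇒m≤n kp<1+n))))

-- A block of index k+1 and length p·d + c ends where the ladder interval for
-- n = p(k+d) + c ends.
ladder-shift : ∀ x p d c k → x + (p * d + c) + k * p ≡ x + (p * (k + d) + c)
ladder-shift = ℕ-Solver.solve-∀

-- For c ≤ p, membership in the staircase c (m+1) 0 is the ladder condition for
-- n = pm + c: its block k+1 is the (k+1)-st interval, of length p(m-k) + c = n - kp.
InStaircase⇒InLadder : ∀ t p c m x → InStaircase t p c (suc m) 0 x → InLadder t p (p * m + c) x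
InStaircase⇒InLadder t p c m x (k , d , k+d+1≡m+1 , lo , hi) with suc-injective k+d+1≡m+1
... | refl = k , subst (suc k * t + k * p ≤_) (ladder-shift x p d c k) (+-monoˡ-≤ (k * p) lo) , hi

InLadder⇒InStaircase : ∀ t p c m x → c ≤ p → InLadder t p (p * m + c) x → InStaircase t p c (suc m) 0 x
InLadder⇒InStaircase t p c m x c≤p (k , lo , hi) =
  k , m ∸ k , cong suc (m+[n∸m]≡n k≤m) , +-cancelʳ-≤ (k * p) _ _ lo′ , hi
  where
  kp<[m+1]p : k * p < suc m * p
  kp<[m+1]p = <-≤-trans (+-cancelˡ-< x (k * p) _ (<-≤-trans (+-monoˡ-< (k * p) hi) lo))
                        (subst (p * m + c ≤_) (trans (+-comm (p * m) p) (cong (_+_ p) (*-comm p m)))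
                               (+-monoʳ-≤ (p * m) c≤p))
  k≤m : k ≤ m
  k≤m = m<1+n⇒m≤n (*-cancelʳ-< p k (suc m) kp<[m+1]p)
  lo′ : suc k * t + k * p ≤ x + (p * (m ∸ k) + c) + k * p
  lo′ = subst (suc k * t + k * p ≤_)
          (sym (trans (ladder-shift x p (m ∸ k) c k) (cong (λ n → x + (p * n + c)) (m+[n∸m]≡n k≤m)))) lo

fits-gamma : ∀ t p m c → p * m + c ≤ t → Fits t p c (suc m) 0
fits-gamma t p m c pm+c≤t = subst (λ n → p * n + c ≤ t + p) (sym (+-identityʳ (suc m)))
  (subst (_≤ t + p) (regroup p m c) (+-monoˡ-≤ p pm+c≤t))
  where
  regroup : ∀ p m c → p * m + c + p ≡ p * suc m + c
  regroup = ℕ-Solver.solve-∀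

gammaBeta : (t p m c : ℕ) → List ℕ
gammaBeta t p m c = staircase t p c (suc m) 0

gammaSize : (t p m c : ℕ) → ℕ
gammaSize t p m c = sum (gammaBeta t p m c) ∸ length (gammaBeta t p m c) C 2

betaSet-gamma : ∀ t p m c {n} .{{_ : NonZero p}} (γ : Partition) → suc n ≡ p * m + c →
                c ≤ p → p * m + c ≤ t → IsGamma t p (suc n) γ →
                betaSet γ ≡ gammaBeta t p m c
betaSet-gamma t p m c {n} γ n+1≡ c≤p pm+c≤t isγ =
  decreasing-ext (betaSet-decreasing γ) (staircase-decreasing t p c (suc m) 0 fits) to from
  where
  fits = fits-gamma t p m c pm+c≤t
  to : ∀ {z} → z ∈ betaSet γ → z ∈ staircase t p c (suc m) 0
  to {z} z∈ = ∈-staircase⁺ t p c (suc m) 0 fits (InLadder⇒InStaircase t p c m z c≤p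
    (subst (λ n′ → InLadder t p n′ z) n+1≡ (InB⇒InLadder t p (suc n) z (Equivalence.to (isγ z) z∈))))
  from : ∀ {z} → z ∈ staircase t p c (suc m) 0 → z ∈ betaSet γ
  from {z} z∈ = Equivalence.from (isγ z) (InLadder⇒InB t p n z
    (subst (λ n′ → InLadder t p n′ z) (sym n+1≡)
      (InStaircase⇒InLadder t p c m z (∈-staircase⁻ t p c (suc m) 0 fits z∈))))

-- The truncated subtraction in gammaSize is exact, as the staircase is strictly decreasing.
gammaSize-spec : ∀ t p m c → p * m + c ≤ t →
  gammaSize t p m c + length (gammaBeta t p m c) C 2 ≡ sum (gammaBeta t p m c)
gammaSize-spec t p m c pm+c≤t =
  m∸n+n≡m (C2≤sum _ (staircase-decreasing t p c (suc m) 0 (fits-gamma t p m c pm+c≤t)))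

-- Any partition satisfying the definition of γ_{pm+c} has size gammaSize t p m c.
-- (Index 0 forces m = c = 0 since p ≥ 1; then both sizes vanish.)
size-gamma : ∀ t p m c {n} .{{_ : NonZero p}} (γ : Partition) → n ≡ p * m + c →
             c ≤ p → p * m + c ≤ t → IsGamma t p n γ → size γ ≡ gammaSize t p m c
size-gamma t p m c {suc n} γ n≡ c≤p pm+c≤t isγ = +-cancelʳ-≡ _ _ _ (begin
  size γ + length β C 2  ≡⟨ subst (λ β′ → size γ + length β′ C 2 ≡ sum β′)
                                  (betaSet-gamma t p m c γ n≡ c≤p pm+c≤t isγ) (size-betaSet γ) ⟩
  sum β                  ≡⟨ sym (gammaSize-spec t p m c pm+c≤t) ⟩
  gammaSize t p m c + length β C 2 ∎)
  where β = gammaBeta t p m c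
size-gamma t p zero    c {zero} γ 0≡c c≤p _ isγ =
  trans (cong sum isγ) (cong (λ ℓ → sum (block t 1 ℓ ++ []) ∸ length (block t 1 ℓ ++ []) C 2) 0≡c)
size-gamma t p (suc m) c {zero} γ 0≡ _ _ _ =
  ⊥-elim (<-irrefl 0≡ (<-≤-trans (>-nonZero⁻¹ p) (≤-trans (m≤m*n p (suc m)) (m≤m+n _ c))))

length-gammaBeta-step : ∀ t p m c →
  length (gammaBeta t p m (suc c)) ≡ length (gammaBeta t p m c) + suc m
length-gammaBeta-step t p m c = begin
  length (gammaBeta t p m (suc c))          ≡⟨ length-staircase t p (suc c) (suc m) 0 ⟩
  suc m * (p * 0 + suc c) + p * (suc m C 2) ≡⟨ regroup m p c (suc m C 2) ⟩
  suc m * (p * 0 + c) + p * (suc m C 2) + suc m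
                                            ≡⟨ cong (_+ suc m) (sym (length-staircase t p c (suc m) 0)) ⟩
  length (gammaBeta t p m c) + suc m        ∎
  where
  regroup : ∀ m p c T → suc m * (p * 0 + suc c) + p * T ≡ suc m * (p * 0 + c) + p * T + suc m
  regroup = ℕ-Solver.solve-∀

-- (m+2)·#β(γ_{pm+c}) = C(m+2,2)·(pm + 2c), since #β = (m+1)c + p·C(m+1,2).
length-gammaBeta-weighted : ∀ t p m c →
  length (gammaBeta t p m c) * suc (suc m) ≡ (suc (suc m) C 2) * (p * m + 2 * c)
length-gammaBeta-weighted t p m c = begin
  length (gammaBeta t p m c) * suc (suc m)
    ≡⟨ cong (_* suc (suc m)) (length-staircase t p c (suc m) 0) ⟩
  (suc m * (p * 0 + c) + p * (suc m C 2)) * suc (suc m)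
    ≡⟨ regroup m p c (suc m C 2) ⟩
  suc (suc m) * suc m * c + p * (suc (suc m) * (suc m C 2))
    ≡⟨ cong₂ (λ x y → x * c + p * y) (sym (double-C2 (suc m))) (C2-shift m) ⟩
  2 * (suc (suc m) C 2) * c + p * (m * (suc (suc m) C 2))
    ≡⟨ regroup′ m p c (suc (suc m) C 2) ⟩
  (suc (suc m) C 2) * (p * m + 2 * c) ∎
  where
  regroup : ∀ m p c T → (suc m * (p * 0 + c) + p * T) * suc (suc m)
                      ≡ suc (suc m) * suc m * c + p * (suc (suc m) * T)
  regroup = ℕ-Solver.solve-∀
  regroup′ : ∀ m p c w → 2 * w * c + p * (m * w) ≡ w * (p * m + 2 * c)
  regroup′ = ℕ-Solver.solve-∀

-- With N = #β(γ_{pm+c}) and K = m+1 it combines Σβ = size + C(#β,2) for both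
-- partitions, the sum step of the staircase, C(N+K,2) = C(N,2) + NK + C(K,2) and the
-- weighted length; m + 2 is first rewritten to suc (suc m).
gammaSize-step : ∀ t p m c → p * m + suc c ≤ t →
  gammaSize t p m (suc c) + ((m + 2) C 2) * (p * m + 2 * c + 1) ≡ gammaSize t p m c + ((m + 2) C 2) * t
gammaSize-step t p m c pm+c+1≤t rewrite +-comm m 2 = +-cancelʳ-≡ (N C 2) _ _ (begin
  a + Cm * (p * m + 2 * c + 1) + N C 2
    ≡⟨ regroup a Cm (p * m + 2 * c) (N C 2) ⟩
  a + Cm * (p * m + 2 * c) + Cm + N C 2
    ≡⟨ cong₂ (λ x y → a + x + y + N C 2) (sym (length-gammaBeta-weighted t p m c)) (suc-C2 K) ⟩
  a + N * suc K + (K + K C 2) + N C 2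
    ≡⟨ regroup′ a N K (K C 2) (N C 2) ⟩
  a + (N C 2 + N * K + K C 2) + N + K
    ≡⟨ cong (λ x → a + x + N + K) (sym (C2-+ N K)) ⟩
  a + (N + K) C 2 + N + K
    ≡⟨ cong (λ x → a + x C 2 + N + K) (sym (length-gammaBeta-step t p m c)) ⟩
  a + length (gammaBeta t p m (suc c)) C 2 + N + K
    ≡⟨ cong (λ x → x + N + K) (gammaSize-spec t p m (suc c) pm+c+1≤t) ⟩
  sum (gammaBeta t p m (suc c)) + N + K
    ≡⟨ sum-staircase-step t p c (suc m) 0 (fits-gamma t p m (suc c) pm+c+1≤t) ⟩
  sum (gammaBeta t p m c) + t * Cm
    ≡⟨ cong (_+ t * Cm) (sym (gammaSize-spec t p m c pm+c≤t)) ⟩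
  b + N C 2 + t * Cm
    ≡⟨ regroup″ b (N C 2) t Cm ⟩
  b + Cm * t + N C 2 ∎)
  where
  K = suc m
  Cm = suc K C 2
  N = length (gammaBeta t p m c)
  a = gammaSize t p m (suc c)
  b = gammaSize t p m c
  pm+c≤t : p * m + c ≤ t
  pm+c≤t = ≤-shrink pm+c+1≤t
  regroup : ∀ a w x y → a + w * (x + 1) + y ≡ a + w * x + w + y
  regroup = ℕ-Solver.solve-∀
  regroup′ : ∀ a N K T U → a + N * suc K + (K + T) + U ≡ a + (U + N * K + T) + N + K
  regroup′ = ℕ-Solver.solve-∀
  regroup″ : ∀ b U t w → b + U + t * w ≡ b + w * t + U
  regroup″ = ℕ-Solver.solve-∀

-- Summing the balance law over c = 0, …, i-1 (Σ (pm + 2c + 1) = ipm + i²):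
--   |γ_{pm+i}| + C(m+2,2)·(ipm + i²) = |γ_{pm}| + C(m+2,2)·it.
gammaSize-telescope : ∀ t p m i → p * m + i ≤ t →
  gammaSize t p m i + ((m + 2) C 2) * (i * p * m + i * i) ≡ gammaSize t p m 0 + ((m + 2) C 2) * (i * t)
gammaSize-telescope t p m zero    _          = refl
gammaSize-telescope t p m (suc i) pm+i+1≤t = begin
  gammaSize t p m (suc i) + Cm * (suc i * p * m + suc i * suc i)
    ≡⟨ regroup (gammaSize t p m (suc i)) Cm p m i ⟩
  gammaSize t p m (suc i) + Cm * (p * m + 2 * i + 1) + Cm * (i * p * m + i * i)
    ≡⟨ cong (_+ Cm * (i * p * m + i * i)) (gammaSize-step t p m i pm+i+1≤t) ⟩
  gammaSize t p m i + Cm * t + Cm * (i * p * m + i * i)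
    ≡⟨ xy∙z≈xz∙y (gammaSize t p m i) (Cm * t) _ ⟩
  gammaSize t p m i + Cm * (i * p * m + i * i) + Cm * t
    ≡⟨ cong (_+ Cm * t) (gammaSize-telescope t p m i pm+i≤t) ⟩
  gammaSize t p m 0 + Cm * (i * t) + Cm * t
    ≡⟨ regroup′ (gammaSize t p m 0) Cm i t ⟩
  gammaSize t p m 0 + Cm * (suc i * t) ∎
  where
  Cm = (m + 2) C 2
  pm+i≤t : p * m + i ≤ t
  pm+i≤t = ≤-shrink pm+i+1≤t
  regroup : ∀ g w p m i → g + w * (suc i * p * m + suc i * suc i)
                        ≡ g + w * (p * m + 2 * i + 1) + w * (i * p * m + i * i)
  regroup = ℕ-Solver.solve-∀
  regroup′ : ∀ g w i t → g + w * (i * t) + w * t ≡ g + w * (suc i * t)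
  regroup′ = ℕ-Solver.solve-∀

balance⇒difference : ∀ a b z u v → a + z * u ≡ b + z * v → + a ℤ.- + b ≡ + z ℤ.* (+ v ℤ.- + u)
balance⇒difference a b z u v balance = begin
  + a ℤ.- + b                                       ≡⟨ insert (+ a) (+ b) (+ z ℤ.* + u) ⟩
  (+ a ℤ.+ + z ℤ.* + u) ℤ.- + b ℤ.- + z ℤ.* + u     ≡⟨ cong (λ w → w ℤ.- + b ℤ.- + z ℤ.* + u) lifted ⟩
  (+ b ℤ.+ + z ℤ.* + v) ℤ.- + b ℤ.- + z ℤ.* + u     ≡⟨ collect (+ b) (+ z) (+ u) (+ v) ⟩
  + z ℤ.* (+ v ℤ.- + u)                             ∎
  where
  lifted : + a ℤ.+ + z ℤ.* + u ≡ + b ℤ.+ + z ℤ.* + v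
  lifted = begin
    + a ℤ.+ + z ℤ.* + u   ≡⟨ cong (λ w → + a ℤ.+ w) (sym (ℤP.pos-* z u)) ⟩
    + (a + z * u)         ≡⟨ cong +_ balance ⟩
    + (b + z * v)         ≡⟨ cong (λ w → + b ℤ.+ w) (ℤP.pos-* z v) ⟩
    + b ℤ.+ + z ℤ.* + v   ∎
  insert : ∀ a b w → a ℤ.- b ≡ a ℤ.+ w ℤ.- b ℤ.- w
  insert = ℤ-Solver.solve-∀
  collect : ∀ b z u v → b ℤ.+ z ℤ.* v ℤ.- b ℤ.- z ℤ.* u ≡ z ℤ.* (v ℤ.- u)
  collect = ℤ-Solver.solve-∀

gammaSize-difference₁ : ∀ t p m c → p * m + suc c ≤ t →
  + gammaSize t p m (suc c) ℤ.- + gammaSize t p m c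
    ≡ + ((m + 2) C 2) ℤ.* (+ t ℤ.- + (p * m) ℤ.- + (2 * suc c) ℤ.+ + 1)
gammaSize-difference₁ t p m c pm+c+1≤t = begin
  + gammaSize t p m (suc c) ℤ.- + gammaSize t p m c
    ≡⟨ balance⇒difference _ _ Cm (p * m + 2 * c + 1) t (gammaSize-step t p m c pm+c+1≤t) ⟩
  + Cm ℤ.* (+ t ℤ.- + (p * m + 2 * c + 1))
    ≡⟨ cong (+ Cm ℤ.*_) (reshape (+ t) (+ (p * m)) (+ (2 * c)) (+ 1)) ⟩
  + Cm ℤ.* (+ t ℤ.- + (p * m) ℤ.- + (2 + 2 * c) ℤ.+ + 1)
    ≡⟨ cong (λ x → + Cm ℤ.* (+ t ℤ.- + (p * m) ℤ.- + x ℤ.+ + 1)) (sym (*-suc 2 c)) ⟩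
  + Cm ℤ.* (+ t ℤ.- + (p * m) ℤ.- + (2 * suc c) ℤ.+ + 1) ∎
  where
  Cm = (m + 2) C 2
  reshape : ∀ T A B one → T ℤ.- (A ℤ.+ B ℤ.+ one) ≡ T ℤ.- A ℤ.- (one ℤ.+ one ℤ.+ B) ℤ.+ one
  reshape = ℤ-Solver.solve-∀

gammaSize-difference₂ : ∀ t p m i → p * m + i ≤ t →
  + gammaSize t p m i ℤ.- + gammaSize t p m 0
    ≡ + ((m + 2) C 2) ℤ.* (+ (i * t) ℤ.- + (i * p * m) ℤ.- + (i * i))
gammaSize-difference₂ t p m i pm+i≤t = begin
  + gammaSize t p m i ℤ.- + gammaSize t p m 0
    ≡⟨ balance⇒difference _ _ Cm (i * p * m + i * i) (i * t) (gammaSize-telescope t p m i pm+i≤t) ⟩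
  + Cm ℤ.* (+ (i * t) ℤ.- + (i * p * m + i * i))
    ≡⟨ cong (+ Cm ℤ.*_) (reshape (+ (i * t)) (+ (i * p * m)) (+ (i * i))) ⟩
  + Cm ℤ.* (+ (i * t) ℤ.- + (i * p * m) ℤ.- + (i * i)) ∎
  where
  Cm = (m + 2) C 2
  reshape : ∀ T A B → T ℤ.- (A ℤ.+ B) ≡ T ℤ.- A ℤ.- B
  reshape = ℤ-Solver.solve-∀

lemma3p4 : (t p : ℕ) → .{{_ : NonZero p}} → 1 ≤ t → 1 ≤ p →
    (i m : ℕ) → 1 ≤ i → i ≤ p → p * m + i ≤ t ∸ 1 →
    (γa γb γc : Partition) →
    IsGamma t p (p * m + i) γa → IsGamma t p (p * m + i ∸ 1) γb → IsGamma t p (p * m) γc →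
    ((+ size γa ℤ.- + size γb) ≡ + ((m + 2) C 2) ℤ.* (+ t ℤ.- + (p * m) ℤ.- + (2 * i) ℤ.+ + 1))
    × ((+ size γa ℤ.- + size γc) ≡ + ((m + 2) C 2) ℤ.* (+ (i * t) ℤ.- + (i * p * m) ℤ.- + (i * i)))
lemma3p4 t p _ _ (suc c) m _ c+1≤p pm+c+1≤t-1 γa γb γc isγa isγb isγc =
    subst₂ (λ a b → + a ℤ.- + b ≡ _) (sym size-a) (sym size-b) (gammaSize-difference₁ t p m c pm+c+1≤t)
  , subst₂ (λ a b → + a ℤ.- + b ≡ _) (sym size-a) (sym size-c) (gammaSize-difference₂ t p m (suc c) pm+c+1≤t)
  where
  pm+c+1≤t : p * m + suc c ≤ t
  pm+c+1≤t = ≤-trans pm+c+1≤t-1 (m∸n≤m t 1)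
  pm+c≤t : p * m + c ≤ t
  pm+c≤t = ≤-shrink pm+c+1≤t
  size-a : size γa ≡ gammaSize t p m (suc c)
  size-a = size-gamma t p m (suc c) γa refl c+1≤p pm+c+1≤t isγa
  size-b : size γb ≡ gammaSize t p m c
  size-b = size-gamma t p m c γb (cong (_∸ 1) (+-suc (p * m) c)) (≤-trans (n≤1+n c) c+1≤p) pm+c≤t isγb
  size-c : size γc ≡ gammaSize t p m 0
  size-c = size-gamma t p m 0 γc (sym (+-identityʳ _)) z≤n (≤-trans (+-monoʳ-≤ (p * m) z≤n) pm+c≤t) isγc
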